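{- Let $\sigma,\omega\in S_\infty$ with $\sigma<_{\mathrm{Bruhat}}\omega$ and $\sigma\approx\omega$. Then $[\sigma,\omega]^f=[\sigma,\omega]$, where $[\sigma,\omega]=\{\nu\in S_\infty:\sigma\le_{\mathrm{Bruhat}}\nu\le_{\mathrm{Bruhat}}\omega\}$.
   Context: $S_\infty$ is the group of bijections $\mathbb N\to\mathbb N$. Bruhat order: $\sigma\le_{\mathrm{Bruhat}}\omega$ iff for every $n$, the $i$-th smallest element of $\{\sigma(1),\dots,\sigma(n)\}$ is at most the $i$-th smallest element of $\{\omega(1),\dots,\omega(n)\}$ for all $i$. $\sigma\approx\nu$ (eventually equal) means $\sigma(n)\ne\nu(n)$ for only finitely many $n$. $[\sigma,\omega]^f=\{\nu\in S_\infty:\sigma\le_{\mathrm{Bruhat}}\nu\le_{\mathrm{Bruhat}}\omega,\ \nu\approx\sigma\}$. -}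

module Defs where

open import Data.Nat using (ℕ; _≤_; _≥_)
open import Data.Nat.Properties using (≤-decTotalOrder)
open import Data.List using (List; map; upTo)
open import Data.List.Sort ≤-decTotalOrder using (sort)
open import Data.List.Relation.Binary.Pointwise using (Pointwise)
open import Data.Product using (_×_; ∃)
open import Relation.Binary.PropositionalEquality using (_≡_; setoid)
open import Function.Bundles using (Bijection; _⤖_)

-- S∞ : bijections ℕ → ℕ  (ℕ here is {0,1,2,...})
S∞ : Set
S∞ = ℕ ⤖ ℕ

app : S∞ → ℕ → ℕ
app σ = Bijection.to σ

sortedPrefix : S∞ → ℕ → List ℕ
sortedPrefix σ n = sort (map (app σ) (upTo n))

_≤B_ : S∞ → S∞ → Set
σ ≤B ω = ∀ n → Pointwise _≤_ (sortedPrefix σ n) (sortedPrefix ω n)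

_≐_ : S∞ → S∞ → Set
σ ≐ ω = ∀ n → app σ n ≡ app ω n

_≈∞_ : S∞ → S∞ → Set
σ ≈∞ ν = ∃ λ N → ∀ n → n ≥ N → app σ n ≡ app ν n

InInterval : S∞ → S∞ → S∞ → Set
InInterval σ ω ν = (σ ≤B ν) × (ν ≤B ω)

InIntervalᶠ : S∞ → S∞ → S∞ → Set
InIntervalᶠ σ ω ν = InInterval σ ω ν × (ν ≈∞ σ)

{-# OPTIONS --safe #-}
-- If σ and ω agree from N on, then for n ≥ N the first n values of σ and of ω
-- form the same set: bijectivity identifies it with the complement of the common
-- tail of values.  So σ and ω have the same sorted n-prefix, and antisymmetry of
-- the pointwise order squeezes the sorted n-prefix of every ν in [σ,ω] onto it.
-- Hence ν and σ have equal prefix multisets for all n ≥ N, and comparing the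
-- prefixes of length n and n + 1 gives ν(n) = σ(n).
module Submission where

open import Defs
open import Data.Product using (_×_; _,_; proj₁)
open import Relation.Nullary using (¬_; yes; no)
open import Data.Nat using (ℕ; _≤_; _<_; _≥_; _<?_; suc)
open import Data.Nat.Properties using (≤-decTotalOrder; ≤-antisym; ≤-trans; ≮⇒≥; n≤1+n; suc-injective)
open import Data.List using (List; []; _∷_; _∷ʳ_; map; upTo; _++_; [_]; length)
open import Data.List.Properties using (length-map; length-upTo; map-++; upTo-∷ʳ; ∷-injectiveˡ)
open import Data.List.Sort ≤-decTotalOrder using (sort; sort-↭; sort-↗)
open import Data.List.Relation.Binary.Pointwise using (Pointwise; Pointwise-≡⇒≡; antisymmetric)
open import Data.List.Relation.Binary.Permutation.Propositional
  using (_↭_; ↭-refl; ↭-sym; ↭-trans; ↭-prep; ↭⇒↭ₛ; module PermutationReasoning)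
open import Data.List.Relation.Binary.Permutation.Propositional.Properties
  using (shift; ↭-length; ↭-singleton-inv; drop-mid; ∷↭∷ʳ)
open import Data.List.Relation.Binary.Subset.Propositional using (_⊆_)
open import Data.List.Relation.Unary.Sorted.TotalOrder.Properties using (↗↭↗⇒≋)
open import Data.List.Relation.Unary.Unique.Propositional using (Unique)
open import Data.List.Relation.Unary.Unique.Propositional.Properties using (map⁺; upTo⁺)
open import Data.List.Relation.Unary.AllPairs using (_∷_)
open import Data.List.Relation.Unary.All as All using ()
open import Data.List.Relation.Unary.Any using (here; there)
open import Data.List.Membership.Propositional using (_∈_)
open import Data.List.Membership.Propositional.Properties
  using (∈-map⁺; ∈-map⁻; ∈-upTo⁺; ∈-upTo⁻; ∈-∃++; ∈-++⁻; ∈-++⁺ˡ; ∈-++⁺ʳ)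
open import Data.Sum using (inj₁; inj₂)
open import Data.Empty using (⊥-elim)
open import Relation.Binary.PropositionalEquality using (_≡_; refl; sym; trans; cong; subst; module ≡-Reasoning)
open import Relation.Binary.Bundles using (DecTotalOrder)
open import Function.Bundles using (Bijection)
open import Function.Definitions using (Injective)

Unique∧⊆∧length≡⇒↭ : ∀ {A : Set} {xs ys : List A} → Unique xs → xs ⊆ ys → length xs ≡ length ys → xs ↭ ys
Unique∧⊆∧length≡⇒↭ {xs = []} {ys = []} _ _ _ = ↭-refl
Unique∧⊆∧length≡⇒↭ {xs = x ∷ xs} {ys = ys} (x∉xs ∷ xs!) xs⊆ys len with ∈-∃++ (xs⊆ys (here refl))
... | ys₁ , ys₂ , refl =
  ↭-trans (↭-prep x (Unique∧⊆∧length≡⇒↭ xs! xs⊆ys₁++ys₂ len′)) (↭-sym (shift x ys₁ ys₂))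
  where
  xs⊆ys₁++ys₂ : xs ⊆ ys₁ ++ ys₂
  xs⊆ys₁++ys₂ z∈xs with ∈-++⁻ ys₁ (xs⊆ys (there z∈xs))
  ... | inj₁ z∈ys₁        = ∈-++⁺ˡ z∈ys₁
  ... | inj₂ (here z≡x)   = ⊥-elim (All.lookup x∉xs z∈xs (sym z≡x))
  ... | inj₂ (there z∈ys₂) = ∈-++⁺ʳ ys₁ z∈ys₂
  len′ : length xs ≡ length (ys₁ ++ ys₂)
  len′ = suc-injective (trans len (↭-length (shift x ys₁ ys₂)))

↭⇒sort≡ : ∀ {xs ys} → xs ↭ ys → sort xs ≡ sort ys
↭⇒sort≡ {xs} {ys} xs↭ys =
  Pointwise-≡⇒≡ (↗↭↗⇒≋ (DecTotalOrder.totalOrder ≤-decTotalOrder) (sort-↗ xs) (sort-↗ ys)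
    (↭⇒↭ₛ (↭-trans (sort-↭ xs) (↭-trans xs↭ys (↭-sym (sort-↭ ys))))))

sort≡⇒↭ : ∀ {xs ys} → sort xs ≡ sort ys → xs ↭ ys
sort≡⇒↭ {xs} {ys} eq = ↭-trans (↭-sym (sort-↭ xs)) (subst (_↭ ys) (sym eq) (sort-↭ ys))

↭-∷-injectiveˡ : ∀ {A : Set} {x y : A} zs → x ∷ zs ↭ y ∷ zs → x ≡ y
↭-∷-injectiveˡ []       p = ∷-injectiveˡ (↭-singleton-inv p)
↭-∷-injectiveˡ (z ∷ zs) p = ↭-∷-injectiveˡ zs (drop-mid [ _ ] [ _ ] p)

values : ∀ {A : Set} → (ℕ → A) → ℕ → List A
values f n = map f (upTo n)

values-suc : ∀ {A : Set} (f : ℕ → A) n → values f (suc n) ≡ values f n ∷ʳ f n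
values-suc f n = begin
  map f (upTo (suc n))     ≡⟨ cong (map f) (sym (upTo-∷ʳ n)) ⟩
  map f (upTo n ∷ʳ n)      ≡⟨ map-++ f (upTo n) [ n ] ⟩
  map f (upTo n) ∷ʳ f n    ∎
  where open ≡-Reasoning

length-values : ∀ {A : Set} (f : ℕ → A) n → length (values f n) ≡ n
length-values f n = trans (length-map f (upTo n)) (length-upTo n)

values-unique : ∀ {f : ℕ → ℕ} → Injective _≡_ _≡_ f → ∀ n → Unique (values f n)
values-unique f-inj n = map⁺ f-inj (upTo⁺ n)

values-↭-suc⇒≡ : ∀ {A : Set} (f g : ℕ → A) n →
  values f n ↭ values g n → values f (suc n) ↭ values g (suc n) → f n ≡ g n
values-↭-suc⇒≡ f g n fₙ↭gₙ fₙ₊₁↭gₙ₊₁ = ↭-∷-injectiveˡ (values g n) (begin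
  f n ∷ values g n      ↭⟨ ↭-prep (f n) (↭-sym fₙ↭gₙ) ⟩
  f n ∷ values f n      ↭⟨ ∷↭∷ʳ (f n) (values f n) ⟩
  values f n ∷ʳ f n     ≡⟨ sym (values-suc f n) ⟩
  values f (suc n)      ↭⟨ fₙ₊₁↭gₙ₊₁ ⟩
  values g (suc n)      ≡⟨ values-suc g n ⟩
  values g n ∷ʳ g n     ↭⟨ ∷↭∷ʳ (g n) (values g n) ⟨
  g n ∷ values g n      ∎)
  where open PermutationReasoning

AgreeFrom : S∞ → S∞ → ℕ → Set
AgreeFrom σ ω N = ∀ n → n ≥ N → app σ n ≡ app ω n

module _ (σ ω : S∞) {N : ℕ} (agree : AgreeFrom σ ω N) {n : ℕ} (n≥N : n ≥ N) where

  -- If σ i = ω j with j ≥ n, then also σ i = σ j, forcing j = i < n.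
  values-⊆ : values (app σ) n ⊆ values (app ω) n
  values-⊆ z∈σ[n] with ∈-map⁻ (app σ) z∈σ[n]
  ... | i , i∈upTo , refl with Bijection.surjective ω (app σ i)
  ... | j , ωj≡σi with j <? n
  ...   | yes j<n = subst (_∈ values (app ω) n) (ωj≡σi refl) (∈-map⁺ (app ω) (∈-upTo⁺ j<n))
  ...   | no  j≮n = ⊥-elim (j≮n (subst (_< n) (sym j≡i) (∈-upTo⁻ i∈upTo)))
    where
    j≡i : j ≡ i
    j≡i = Bijection.injective σ (trans (agree j (≤-trans n≥N (≮⇒≥ j≮n))) (ωj≡σi refl))

  agreeFrom⇒values-↭ : values (app σ) n ↭ values (app ω) n
  agreeFrom⇒values-↭ = Unique∧⊆∧length≡⇒↭ (values-unique (Bijection.injective σ) n) values-⊆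
    (trans (length-values (app σ) n) (sym (length-values (app ω) n)))

  agreeFrom⇒sortedPrefix≡ : sortedPrefix σ n ≡ sortedPrefix ω n
  agreeFrom⇒sortedPrefix≡ = ↭⇒sort≡ agreeFrom⇒values-↭

InInterval⇒sortedPrefix≡ : ∀ (σ ω ν : S∞) → InInterval σ ω ν → ∀ n →
  sortedPrefix σ n ≡ sortedPrefix ω n → sortedPrefix ν n ≡ sortedPrefix σ n
InInterval⇒sortedPrefix≡ σ ω ν (σ≤ν , ν≤ω) n σ≡ω =
  Pointwise-≡⇒≡ (antisymmetric ≤-antisym ν≤σ (σ≤ν n))
  where
  ν≤σ : Pointwise _≤_ (sortedPrefix ν n) (sortedPrefix σ n)
  ν≤σ = subst (Pointwise _≤_ (sortedPrefix ν n)) (sym σ≡ω) (ν≤ω n)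

InInterval⇒≈∞ : ∀ (σ ω ν : S∞) → σ ≈∞ ω → InInterval σ ω ν → ν ≈∞ σ
InInterval⇒≈∞ σ ω ν (N , agree) ν∈[σ,ω] = N , ν≡σ
  where
  values-ν↭σ : ∀ {n} → n ≥ N → values (app ν) n ↭ values (app σ) n
  values-ν↭σ {n} n≥N =
    sort≡⇒↭ (InInterval⇒sortedPrefix≡ σ ω ν ν∈[σ,ω] n (agreeFrom⇒sortedPrefix≡ σ ω agree n≥N))

  ν≡σ : AgreeFrom ν σ N
  ν≡σ n n≥N = values-↭-suc⇒≡ (app ν) (app σ) n
    (values-ν↭σ n≥N) (values-ν↭σ (≤-trans n≥N (n≤1+n n)))

mainTheorem8 : (σ ω : S∞) → σ ≤B ω → ¬ (σ ≐ ω) → σ ≈∞ ω →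
    (ν : S∞) → (InIntervalᶠ σ ω ν → InInterval σ ω ν) × (InInterval σ ω ν → InIntervalᶠ σ ω ν)
mainTheorem8 σ ω _ _ σ≈ω ν = proj₁ , λ ν∈[σ,ω] → ν∈[σ,ω] , InInterval⇒≈∞ σ ω ν σ≈ω ν∈[σ,ω]
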